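{- There are continuum many varieties of Boolean frames that are normal, extensive, idempotent and monotone and lack the congruence extension property. Consequently, there are continuum many axiomatic extensions of $\vdash_{\mathbf{ENMRI}}$ that do not admit a local deduction detachment theorem.
   Context: A Boolean frame is an algebra $\langle A,\sqcap,-,0,f\rangle$ where $\langle A,\sqcap,-,0\rangle$ is a Boolean algebra and $f:A\to A$ is an arbitrary unary operation ($\sqcup$, $1$, $\le$ as usual). It is normal if $f(0)=0$, extensive if $x\le f(x)$ for all $x$, idempotent if $f(f(x))=f(x)$ for all $x$, monotone if $f(x)\sqcup f(y)\le f(x\sqcup y)$ for all $x,y$. An algebra has the congruence extension property (CEP) if for every subalgebra $B$ and every congruence $\Theta$ of $B$ there is a congruence $\Psi$ of the algebra with $\Psi\cap(B\times B)=\Theta$; a variety has CEP if all its members do, and lacks it otherwise. Modal formulas are built from countably many propositional letters with $\land,\neg,\bot,\Diamond$ (other connectives defined as usual, $\Box=\neg\Diamond\neg$). The system $\mathbf{E}$ has all instances of propositional tautologies as axioms and the rules modus ponens and (RE): from $\varphi\leftrightarrow\psi$ infer $\Box\varphi\leftrightarrow\Box\psi$; $\Gamma\vdash_{\mathbf{S}}\psi$ means $\psi$ has a Hilbert-style derivation from $\Gamma$ using axioms and rules of $\mathbf{S}$. A consequence relation $\vdash$ is an axiomatic extension of $\vdash_{\mathbf{E}}$ if there is a set of formulas $\Sigma$ with $\Gamma\vdash\psi$ iff $\Gamma\cup\Sigma\vdash_{\mathbf{E}}\psi$ for all $\Gamma,\psi$. $\mathbf{ENMRI}$ is $\mathbf{E}$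 extended by all instances of the axiom schemes $\Diamond\bot\leftrightarrow\bot$, $(\Diamond\varphi\lor\Diamond\psi)\to\Diamond(\varphi\lor\psi)$, $\varphi\to\Diamond\varphi$, and $\Diamond\Diamond\varphi\leftrightarrow\Diamond\varphi$. A consequence relation $\vdash$ admits a local deduction detachment theorem (LDDT) if for all $\Sigma\cup\{\varphi,\psi\}$ there is a finite set of formulas $L(p,q)$ such that $\Sigma\cup\{\varphi\}\vdash\psi$ iff $\Sigma\vdash L(\varphi,\psi)$. -}

module Defs where

open import Level using (0ℓ; _⊔_) renaming (suc to lsuc)
open import Data.Nat using (ℕ)
open import Data.Bool using (Bool; true; false; not) renaming (_∧_ to _∧ᵇ_)
open import Data.Product using (Σ; Σ-syntax; _×_; _,_)
open import Data.List using (List)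
open import Data.List.Relation.Unary.All using (All)
open import Relation.Binary.PropositionalEquality using (_≡_)
import Relation.Nullary
open import Relation.Unary using (Pred; _∪_; ｛_｝)
open import Algebra.Lattice.Bundles using (BooleanAlgebra)
import Data.Unit

-- Modal formulas / terms over the signature ⟨⊓, -, 0, f⟩
-- (the same syntax serves as modal formulas (∧, ¬, ⊥, ◇) and as
-- algebraic terms (⊓, -, 0, f)); variables drawn from V.

infixr 7 _∧′_
infix  8 ¬′_ ◇_

data Fm (V : Set) : Set where
  var  : V → Fm V
  _∧′_ : Fm V → Fm V → Fm V
  ¬′_  : Fm V → Fm V
  ⊥′   : Fm V
  ◇_   : Fm V → Fm V

module _ {V : Set} where
  infix 8 □_
  infixr 6 _∨′_
  infixr 5 _⇒_
  infix 4 _⇔′_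

  ⊤′ : Fm V
  ⊤′ = ¬′ ⊥′

  _∨′_ : Fm V → Fm V → Fm V
  φ ∨′ ψ = ¬′ (¬′ φ ∧′ ¬′ ψ)

  _⇒_ : Fm V → Fm V → Fm V
  φ ⇒ ψ = ¬′ (φ ∧′ ¬′ ψ)

  _⇔′_ : Fm V → Fm V → Fm V
  φ ⇔′ ψ = (φ ⇒ ψ) ∧′ (ψ ⇒ φ)

  □_ : Fm V → Fm V
  □ φ = ¬′ ◇ ¬′ φ

Form : Set
Form = Fm ℕ

sub : {V W : Set} → (V → Fm W) → Fm V → Fm W
sub σ (var x)  = σ x
sub σ (φ ∧′ ψ) = sub σ φ ∧′ sub σ ψ
sub σ (¬′ φ)   = ¬′ sub σ φ
sub σ ⊥′       = ⊥′
sub σ (◇ φ)    = ◇ sub σ φ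

data PFm : Set where
  pvar : ℕ → PFm
  _p∧_ : PFm → PFm → PFm
  p¬_  : PFm → PFm
  p⊥   : PFm

evalP : (ℕ → Bool) → PFm → Bool
evalP v (pvar x) = v x
evalP v (p p∧ q) = evalP v p ∧ᵇ evalP v q
evalP v (p¬ p)   = not (evalP v p)
evalP v p⊥       = false

Tautology : PFm → Set
Tautology p = (v : ℕ → Bool) → evalP v p ≡ true

embed : PFm → Form
embed (pvar x) = var x
embed (p p∧ q) = embed p ∧′ embed q
embed (p¬ p)   = ¬′ embed p
embed p⊥       = ⊥′

TautInstance : Form → Set
TautInstance φ = Σ[ p ∈ PFm ] Σ[ σ ∈ (ℕ → Form) ] (Tautology p × sub σ (embed p) ≡ φ)

infix 3 _⊢E_

data _⊢E_ (Γ : Pred Form 0ℓ) : Form → Set where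
  hyp  : ∀ {φ} → Γ φ → Γ ⊢E φ
  taut : ∀ {φ} → TautInstance φ → Γ ⊢E φ
  mp   : ∀ {φ ψ} → Γ ⊢E φ → Γ ⊢E (φ ⇒ ψ) → Γ ⊢E ψ
  re   : ∀ {φ ψ} → Γ ⊢E (φ ⇔′ ψ) → Γ ⊢E (□ φ ⇔′ □ ψ)

ConsRel : Set₁
ConsRel = Pred Form 0ℓ → Form → Set

axExt : Pred Form 0ℓ → ConsRel
axExt Σ′ Γ φ = (Γ ∪ Σ′) ⊢E φ

data AxENMRI : Pred Form 0ℓ where
  axN : AxENMRI (◇ ⊥′ ⇔′ ⊥′)
  axM : ∀ φ ψ → AxENMRI ((◇ φ ∨′ ◇ ψ) ⇒ ◇ (φ ∨′ ψ))
  axR : ∀ φ → AxENMRI (φ ⇒ ◇ φ)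
  axI : ∀ φ → AxENMRI (◇ ◇ φ ⇔′ ◇ φ)

_⊢ENMRI_ : ConsRel
_⊢ENMRI_ = axExt AxENMRI

IsAxExtOfENMRI : ConsRel → Set₁
IsAxExtOfENMRI ⊢ =
  Σ[ Σ′ ∈ Pred Form 0ℓ ]
    ((∀ Γ φ → (⊢ Γ φ → axExt Σ′ Γ φ) × (axExt Σ′ Γ φ → ⊢ Γ φ))
    × (∀ Γ φ → Γ ⊢ENMRI φ → ⊢ Γ φ))

-- Local deduction detachment theorem: a family {L i}_{i ∈ I} of finite
-- sets of formulas in two variables p (= false), q (= true) such that
--   Γ ∪ {φ} ⊢ ψ  iff  Γ ⊢ L i (φ, ψ) for some i.
inst2 : Form → Form → Fm Bool → Form
inst2 φ ψ = sub (λ { false → φ ; true → ψ })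

LDDT : ConsRel → Set₁
LDDT ⊢ =
  Σ[ I ∈ Set ] Σ[ L ∈ (I → List (Fm Bool)) ]
    (∀ Γ φ ψ →
      (⊢ (Γ ∪ ｛ φ ｝) ψ → Σ[ i ∈ I ] All (λ χ → ⊢ Γ (inst2 φ ψ χ)) (L i))
      × (Σ[ i ∈ I ] All (λ χ → ⊢ Γ (inst2 φ ψ χ)) (L i) → ⊢ (Γ ∪ ｛ φ ｝) ψ))

record BooleanFrame (c ℓ : Level.Level) : Set (lsuc (c ⊔ ℓ)) where
  field
    ba     : BooleanAlgebra c ℓ
  open BooleanAlgebra ba public
  field
    f      : Carrier → Carrier
    f-cong : ∀ {x y} → x ≈ y → f x ≈ f y

  _≤_ : Carrier → Carrier → Set ℓ
  x ≤ y = (x ∧ y) ≈ x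

  ⟦_⟧ : Form → (ℕ → Carrier) → Carrier
  ⟦ var x  ⟧ ρ = ρ x
  ⟦ t ∧′ u ⟧ ρ = ⟦ t ⟧ ρ ∧ ⟦ u ⟧ ρ
  ⟦ ¬′ t   ⟧ ρ = ¬ ⟦ t ⟧ ρ
  ⟦ ⊥′     ⟧ ρ = ⊥
  ⟦ ◇ t    ⟧ ρ = f (⟦ t ⟧ ρ)

Frame : Set₁
Frame = BooleanFrame 0ℓ 0ℓ

module _ (A : Frame) where
  open BooleanFrame A

  Normal Extensive Idempotent Monotone : Set
  Normal     = f ⊥ ≈ ⊥
  Extensive  = ∀ x → x ≤ f x
  Idempotent = ∀ x → f (f x) ≈ f x
  Monotone   = ∀ x y → (f x ∨ f y) ≤ f (x ∨ y)

  NEIM : Set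
  NEIM = Normal × Extensive × Idempotent × Monotone

  IsSubuniverse : Pred Carrier 0ℓ → Set
  IsSubuniverse B =
    (∀ {x y} → B x → B y → B (x ∧ y)) × (∀ {x} → B x → B (¬ x))
    × B ⊥ × (∀ {x} → B x → B (f x))

  -- congruences of the subalgebra with universe B (relations on B)
  IsCongruenceOn : Pred Carrier 0ℓ → (Carrier → Carrier → Set) → Set
  IsCongruenceOn B Θ =
      (∀ {x y} → B x → B y → x ≈ y → Θ x y)
    × (∀ {x y} → B x → B y → Θ x y → Θ y x)
    × (∀ {x y z} → B x → B y → B z → Θ x y → Θ y z → Θ x z)
    × (∀ {x y u v} → B x → B y → B u → B v → Θ x y → Θ u v → Θ (x ∧ u) (y ∧ v))
    × (∀ {x y} → B x → B y → Θ x y → Θ (¬ x) (¬ y))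
    × (∀ {x y} → B x → B y → Θ x y → Θ (f x) (f y))

  IsCongruence : (Carrier → Carrier → Set) → Set
  IsCongruence = IsCongruenceOn (λ _ → Data.Unit.⊤)

  CEP : Set₁
  CEP = ∀ (B : Pred Carrier 0ℓ) (Θ : Carrier → Carrier → Set) →
        IsSubuniverse B → IsCongruenceOn B Θ →
        Σ[ Ψ ∈ (Carrier → Carrier → Set) ]
          (IsCongruence Ψ × (∀ x y → B x → B y → (Ψ x y → Θ x y) × (Θ x y → Ψ x y)))

  _⊨_ : Pred (Form × Form) 0ℓ → Set
  _⊨_ E = ∀ t u → E (t , u) → ∀ (ρ : ℕ → Carrier) → ⟦ t ⟧ ρ ≈ ⟦ u ⟧ ρ

Equation : Set
Equation = Form × Form

{-# OPTIONS --safe #-}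
module Submission where

-- Let closeFrame m be the Boolean algebra of subsets of an m-element set with
-- f S = S when S has at most one point and f S = 1 otherwise; it is normal,
-- extensive, idempotent and monotone. The letters p₀, …, p_{K-1} split the points
-- into K + 1 blocks according to the first letter that holds, and sizeFormula K
-- is built so that refuting it at a point forces every block to be a singleton.
-- So for K ≥ 2 it is valid in closeFrame m iff m ≠ K + 1, and adding
-- sizeFormula (n + 3) for each n ∈ α gives logics and varieties that the algebras
-- closeFrame (n + 4) tell apart: α ↦ logic α is injective on 2^ℕ.
-- All of them hold in closeFrame 3. Its subalgebra of subsets S with 0 ∈ S ⇔ 1 ∈ S
-- is isomorphic to closeFrame 1 via S ↦ S ∩ {0}, and the kernel of this map does
-- not extend to a congruence of closeFrame 3, so CEP fails. For a suitable
-- valuation in closeFrame 3, the formulas valid under it derive p₁ from p₀ (by RE),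
-- while S ↦ S ∩ {0} carries their consequences in p₀, p₁ over to closeFrame 1,
-- where p₀ holds and p₁ fails; so there is no local deduction detachment set.

open import Defs
open import Level using (0ℓ)
open import Algebra.Lattice.Bundles using (BooleanAlgebra)
open import Data.Bool using (Bool; true; false; not; _∧_; _∨_; T; if_then_else_)
open import Data.Bool.Properties using (T-∧; T-∨; T-≡; ∨-idem; ∨-∧-booleanAlgebra)
open import Data.Empty using (⊥-elim)
open import Data.Fin using (Fin; zero; suc; toℕ; punchIn; punchOut)
open import Data.Fin.Patterns using (0F; 1F; 2F)
open import Data.Fin.Properties
  using (_≟_; any?; suc-injective; punchIn-punchOut; punchInᵢ≢i; cantor-schröder-bernstein)
open import Data.List.Relation.Unary.All as All using (All)
open import Data.Nat using (ℕ; zero; suc; _+_; _≡ᵇ_)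
open import Data.Nat.Properties using (+-cancelˡ-≡)
open import Data.Product using (Σ-syntax; ∃₂; ∃-syntax; _×_; _,_; proj₁; proj₂)
import Data.Product as Product
open import Data.Sum using (_⊎_; inj₁; inj₂)
import Data.Sum as Sum
open import Data.Vec.Functional using ([]; _∷_)
open import Function using (_∘_; id; _⇔_; mk⇔; Equivalence; case_of_)
open import Relation.Binary.PropositionalEquality
  using (_≡_; _≢_; _≗_; refl; sym; trans; cong; cong₂; subst)
open import Relation.Nullary using (¬_)
open import Relation.Nullary.Decidable
  using (Dec; yes; no; ¬?; _×-dec_; ⌊_⌋; toWitness; fromWitness; T?; decidable-stable)
open import Relation.Unary using (Pred; _∪_; ∅; ｛_｝)

open Equivalence using (to; from)

T-not : ∀ {a} → T (not a) ⇔ (¬ T a)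
T-not {true}  = mk⇔ (λ ()) (λ ¬t → ¬t _)
T-not {false} = mk⇔ (λ _ ()) _

T-⇒ : ∀ {a b} → T (not (a ∧ not b)) ⇔ (T a → T b)
T-⇒ {true}  {true}  = mk⇔ _ _
T-⇒ {true}  {false} = mk⇔ (λ ()) (λ f → f _)
T-⇒ {false}         = mk⇔ (λ _ ()) _

T-⇔ : ∀ {a b} → T (not (a ∧ not b) ∧ not (b ∧ not a)) ⇔ (a ≡ b)
T-⇔ {true}  {true}  = mk⇔ (λ _ → refl) _
T-⇔ {true}  {false} = mk⇔ (λ ()) (λ ())
T-⇔ {false} {true}  = mk⇔ (λ ()) (λ ())
T-⇔ {false} {false} = mk⇔ (λ _ → refl) _

T-¬∧¬ : ∀ {a b} → T (not (not a ∧ not b)) ⇔ (T a ⊎ T b)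
T-¬∧¬ {true}          = mk⇔ inj₁ _
T-¬∧¬ {false} {true}  = mk⇔ inj₂ _
T-¬∧¬ {false} {false} = mk⇔ (λ ()) λ { (inj₁ ()) ; (inj₂ ()) }

T-⇔⇒≡ : ∀ {a b} → T a ⇔ T b → a ≡ b
T-⇔⇒≡ {true}  {true}  _   = refl
T-⇔⇒≡ {true}  {false} a⇔b = ⊥-elim (a⇔b .to _)
T-⇔⇒≡ {false} {true}  a⇔b = ⊥-elim (a⇔b .from _)
T-⇔⇒≡ {false} {false} _   = refl

≡-unless-separated : ∀ {a b} → (a ≡ true → ¬ b ≡ false) → (b ≡ true → ¬ a ≡ false) → a ≡ b
≡-unless-separated {true}  {true}  _   _   = refl
≡-unless-separated {true}  {false} a≢b _   = ⊥-elim (a≢b refl refl)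
≡-unless-separated {false} {true}  _   b≢a = ⊥-elim (b≢a refl refl)
≡-unless-separated {false} {false} _   _   = refl

module _ (A : Frame) where
  open BooleanFrame A renaming (¬_ to -_; _∧_ to _⊓_; _∨_ to _⊔_; sym to ≈-sym; trans to ≈-trans)
  open import Algebra.Lattice.Properties.BooleanAlgebra ba
    using (¬⊥≈⊤; ¬⊤≈⊥; ¬-involutive; deMorgan₁; ∧-identityʳ; ∨-identityʳ; ∨-zeroʳ)
  open import Relation.Binary.Reasoning.Setoid setoid

  ⊓≈⊤⇒≈⊤ : ∀ {a b} → a ⊓ b ≈ ⊤ → a ≈ ⊤
  ⊓≈⊤⇒≈⊤ {a} {b} a⊓b≈⊤ = begin
    a           ≈⟨ ∨-absorbs-∧ a b ⟨
    a ⊔ (a ⊓ b) ≈⟨ ∨-congˡ a⊓b≈⊤ ⟩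
    a ⊔ ⊤       ≈⟨ ∨-zeroʳ a ⟩
    ⊤           ∎

  ⇒≈⊤⇒≤ : ∀ {a b} → - (a ⊓ - b) ≈ ⊤ → a ≤ b
  ⇒≈⊤⇒≤ {a} {b} a⇒b≈⊤ = begin
    a ⊓ b               ≈⟨ ∨-identityʳ _ ⟨
    (a ⊓ b) ⊔ ⊥         ≈⟨ ∨-congˡ a⊓-b≈⊥ ⟨
    (a ⊓ b) ⊔ (a ⊓ - b) ≈⟨ ∧-distribˡ-∨ a b (- b) ⟨
    a ⊓ (b ⊔ - b)       ≈⟨ ∧-congˡ (∨-complementʳ b) ⟩
    a ⊓ ⊤               ≈⟨ ∧-identityʳ a ⟩
    a                   ∎
    where
    a⊓-b≈⊥ : a ⊓ - b ≈ ⊥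
    a⊓-b≈⊥ = ≈-trans (≈-sym (¬-involutive _)) (≈-trans (¬-cong a⇒b≈⊤) ¬⊤≈⊥)

  ≤-antisym : ∀ {a b} → a ≤ b → b ≤ a → a ≈ b
  ≤-antisym {a} {b} a≤b b≤a = ≈-trans (≈-sym a≤b) (≈-trans (∧-comm a b) b≤a)

  ≤-resp-≈ : ∀ {a a′ b b′} → a ≈ a′ → b ≈ b′ → a ≤ b → a′ ≤ b′
  ≤-resp-≈ a≈a′ b≈b′ a≤b = ≈-trans (∧-cong (≈-sym a≈a′) (≈-sym b≈b′)) (≈-trans a≤b a≈a′)

  ⇔≈⊤⇒≈ : ∀ {a b} → - (a ⊓ - b) ⊓ - (b ⊓ - a) ≈ ⊤ → a ≈ b
  ⇔≈⊤⇒≈ a⇔b≈⊤ = ≤-antisym (⇒≈⊤⇒≤ (⊓≈⊤⇒≈⊤ a⇔b≈⊤)) (⇒≈⊤⇒≤ (⊓≈⊤⇒≈⊤ (≈-trans (∧-comm _ _) a⇔b≈⊤)))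

  -⊓-≈⊔ : ∀ a b → - (- a ⊓ - b) ≈ a ⊔ b
  -⊓-≈⊔ a b = ≈-trans (deMorgan₁ (- a) (- b)) (∨-cong (¬-involutive a) (¬-involutive b))

  AxENMRI-valid⇒NEIM : (∀ {φ} → AxENMRI φ → ∀ ρ → ⟦ φ ⟧ ρ ≈ ⟦ ⊤′ ⟧ ρ) → NEIM A
  AxENMRI-valid⇒NEIM valid⊤′ =
      ⇔≈⊤⇒≈ (valid axN (λ _ → ⊥))
    , (λ x → ⇒≈⊤⇒≤ (valid (axR (var 0)) (λ _ → x)))
    , (λ x → ⇔≈⊤⇒≈ (valid (axI (var 0)) (λ _ → x)))
    , (λ x y → ≤-resp-≈ (-⊓-≈⊔ (f x) (f y)) (f-cong (-⊓-≈⊔ x y))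
                 (⇒≈⊤⇒≤ (valid (axM (var 0) (var 1)) λ { zero → x ; (suc _) → y })))
    where
    valid : ∀ {φ} → AxENMRI φ → ∀ ρ → ⟦ φ ⟧ ρ ≈ ⊤
    valid ax ρ = ≈-trans (valid⊤′ ax ρ) ¬⊥≈⊤

-- Powerset frames

Subset : Set → Set
Subset X = X → Bool

module _ {X : Set} where

  infix 4 _∈_ _⊆_

  _∈_ : X → Subset X → Set
  x ∈ S = T (S x)

  _⊆_ : Subset X → Subset X → Set
  S ⊆ S′ = ∀ {x} → x ∈ S → x ∈ S′

subsetBooleanAlgebra : Set → BooleanAlgebra 0ℓ 0ℓ
subsetBooleanAlgebra X = record
  { Carrier = Subset X
  ; _≈_ = _≗_
  ; _∨_ = λ S S′ x → S x ∨ S′ x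
  ; _∧_ = λ S S′ x → S x ∧ S′ x
  ; ¬_ = λ S x → not (S x)
  ; ⊤ = λ _ → true
  ; ⊥ = λ _ → false
  ; isBooleanAlgebra = record
    { isDistributiveLattice = record
      { isLattice = record
        { isEquivalence = record
          { refl = λ _ → refl ; sym = λ p x → sym (p x) ; trans = λ p q x → trans (p x) (q x) }
        ; ∨-comm = λ S S′ x → B.∨-comm (S x) (S′ x)
        ; ∨-assoc = λ S S′ S″ x → B.∨-assoc (S x) (S′ x) (S″ x)
        ; ∨-cong = λ p q x → cong₂ _∨_ (p x) (q x)
        ; ∧-comm = λ S S′ x → B.∧-comm (S x) (S′ x)
        ; ∧-assoc = λ S S′ S″ x → B.∧-assoc (S x) (S′ x) (S″ x)
        ; ∧-cong = λ p q x → cong₂ _∧_ (p x) (q x)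
        ; absorptive = (λ S S′ x → B.∨-absorbs-∧ (S x) (S′ x))
                     , (λ S S′ x → B.∧-absorbs-∨ (S x) (S′ x))
        }
      ; ∨-distrib-∧ = (λ S S′ S″ x → B.∨-distribˡ-∧ (S x) (S′ x) (S″ x))
                    , (λ S S′ S″ x → B.∨-distribʳ-∧ (S x) (S′ x) (S″ x))
      ; ∧-distrib-∨ = (λ S S′ S″ x → B.∧-distribˡ-∨ (S x) (S′ x) (S″ x))
                    , (λ S S′ S″ x → B.∧-distribʳ-∨ (S x) (S′ x) (S″ x))
      }
    ; ∨-complement = (λ S x → B.∨-complementˡ (S x)) , (λ S x → B.∨-complementʳ (S x))
    ; ∧-complement = (λ S x → B.∧-complementˡ (S x)) , (λ S x → B.∧-complementʳ (S x))
    ; ¬-cong = λ p x → cong not (p x)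
    }
  }
  where module B = BooleanAlgebra ∨-∧-booleanAlgebra

⋁ : ∀ {n} → (Fin n → Form) → Form
⋁ {zero}  φ = ⊥′
⋁ {suc n} φ = φ zero ∨′ ⋁ (φ ∘ suc)

firstTrue : (ℕ → Bool) → (K : ℕ) → Fin (suc K)
firstTrue v zero    = zero
firstTrue v (suc K) = if v 0 then zero else suc (firstTrue (v ∘ suc) K)

cell : (ℕ → Form) → (K : ℕ) → Fin (suc K) → Form
cell σ zero    zero    = ⊤′
cell σ (suc K) zero    = σ 0
cell σ (suc K) (suc i) = ¬′ σ 0 ∧′ cell (σ ∘ suc) K i

module Powerset {X : Set} (c : Subset X → Subset X) (c-cong : ∀ {S S′} → S ≗ S′ → c S ≗ c S′) where

  frame : Frame
  frame = record { ba = subsetBooleanAlgebra X ; f = c ; f-cong = c-cong }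

  open BooleanFrame frame public using (⟦_⟧)

  infix 4 _⊩_

  _⊩_ : (ℕ → Subset X) → Form → Set
  ρ ⊩ φ = ∀ x → x ∈ ⟦ φ ⟧ ρ

  ⟦sub-embed⟧ : ∀ p σ ρ x → ⟦ sub σ (embed p) ⟧ ρ x ≡ evalP (λ k → ⟦ σ k ⟧ ρ x) p
  ⟦sub-embed⟧ (pvar k) σ ρ x = refl
  ⟦sub-embed⟧ (p p∧ q) σ ρ x = cong₂ _∧_ (⟦sub-embed⟧ p σ ρ x) (⟦sub-embed⟧ q σ ρ x)
  ⟦sub-embed⟧ (p¬ p)   σ ρ x = cong not (⟦sub-embed⟧ p σ ρ x)
  ⟦sub-embed⟧ p⊥       σ ρ x = refl

  ⊢E-sound : ∀ {Δ φ} ρ → (∀ {ψ} → Δ ψ → ρ ⊩ ψ) → Δ ⊢E φ → ρ ⊩ φ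
  ⊢E-sound ρ ⊩Δ (hyp δ) = ⊩Δ δ
  ⊢E-sound ρ ⊩Δ (taut (p , σ , p-taut , refl)) x = T-≡ .from (trans (⟦sub-embed⟧ p σ ρ x) (p-taut _))
  ⊢E-sound ρ ⊩Δ (mp ⊢φ ⊢φ⇒ψ) x = T-⇒ .to (⊢E-sound ρ ⊩Δ ⊢φ⇒ψ x) (⊢E-sound ρ ⊩Δ ⊢φ x)
  ⊢E-sound ρ ⊩Δ (re ⊢φ⇔ψ) x =
    T-⇔ .from (cong not (c-cong (λ y → cong not (T-⇔ .to (⊢E-sound ρ ⊩Δ ⊢φ⇔ψ y))) x))

  record IsNEIM : Set where
    field
      normal     : c (λ _ → false) ≗ (λ _ → false)
      extensive  : ∀ S → S ⊆ c S
      idempotent : ∀ S → c (c S) ⊆ c S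
      monotone   : ∀ {S S′} → S ⊆ S′ → c S ⊆ c S′

  module _ (neim : IsNEIM) where
    open IsNEIM neim

    AxENMRI-valid : ∀ ρ {φ} → AxENMRI φ → ρ ⊩ φ
    AxENMRI-valid ρ axN       x = T-⇔ .from (normal x)
    AxENMRI-valid ρ (axM φ ψ) x = T-⇒ .from λ x∈◇φ∨◇ψ → case T-¬∧¬ .to x∈◇φ∨◇ψ of λ
      { (inj₁ x∈◇φ) → monotone (λ x∈φ → T-¬∧¬ .from (inj₁ x∈φ)) x∈◇φ
      ; (inj₂ x∈◇ψ) → monotone (λ x∈ψ → T-¬∧¬ .from (inj₂ x∈ψ)) x∈◇ψ }
    AxENMRI-valid ρ (axR φ)   x = T-⇒ .from (extensive _)
    AxENMRI-valid ρ (axI φ)   x = T-⇔ .from (T-⇔⇒≡ (mk⇔ (idempotent _) (extensive _)))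

  module Membership (ρ : ℕ → Subset X) where

    ∈-¬′ : ∀ φ {x} → x ∈ ⟦ ¬′ φ ⟧ ρ ⇔ (¬ x ∈ ⟦ φ ⟧ ρ)
    ∈-¬′ φ = T-not

    ∈-∧′ : ∀ φ ψ {x} → x ∈ ⟦ φ ∧′ ψ ⟧ ρ ⇔ (x ∈ ⟦ φ ⟧ ρ × x ∈ ⟦ ψ ⟧ ρ)
    ∈-∧′ φ ψ = T-∧

    ∈-∨′ : ∀ φ ψ {x} → x ∈ ⟦ φ ∨′ ψ ⟧ ρ ⇔ (x ∈ ⟦ φ ⟧ ρ ⊎ x ∈ ⟦ ψ ⟧ ρ)
    ∈-∨′ φ ψ = T-¬∧¬

    ∈-⋁ : ∀ {n} (φ : Fin n → Form) {x} → x ∈ ⟦ ⋁ φ ⟧ ρ ⇔ (∃[ i ] x ∈ ⟦ φ i ⟧ ρ)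
    ∈-⋁ {zero}  φ = mk⇔ (λ ()) (λ ())
    ∈-⋁ {suc n} φ = mk⇔
      (Sum.[ (zero ,_) , Product.map suc id ∘ ∈-⋁ (φ ∘ suc) .to ] ∘ ∈-∨′ (φ zero) (⋁ (φ ∘ suc)) .to)
      (∈-∨′ (φ zero) (⋁ (φ ∘ suc)) .from ∘ λ
        { (zero  , x∈φ₀) → inj₁ x∈φ₀
        ; (suc i , x∈φᵢ) → inj₂ (∈-⋁ (φ ∘ suc) .from (i , x∈φᵢ)) })

    ∈-cell : ∀ σ K i {x} → x ∈ ⟦ cell σ K i ⟧ ρ ⇔ firstTrue (λ l → ⟦ σ l ⟧ ρ x) K ≡ i
    ∈-cell σ zero    zero        = mk⇔ (λ _ → refl) _
    ∈-cell σ (suc K) zero    {x} with ⟦ σ 0 ⟧ ρ x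
    ... | true  = mk⇔ (λ _ → refl) _
    ... | false = mk⇔ (λ ()) (λ ())
    ∈-cell σ (suc K) (suc i) {x} with ⟦ σ 0 ⟧ ρ x
    ... | true  = mk⇔ (λ ()) (λ ())
    ... | false = mk⇔ (cong suc ∘ ∈-cell (σ ∘ suc) K i .to) (∈-cell (σ ∘ suc) K i .from ∘ suc-injective)

module _ {m : ℕ} where

  HasTwo : Subset (Fin m) → Set
  HasTwo S = ∃₂ λ x y → x ≢ y × x ∈ S × y ∈ S

  hasTwo? : ∀ S → Dec (HasTwo S)
  hasTwo? S = any? λ x → any? λ y → ¬? (x ≟ y) ×-dec T? (S x) ×-dec T? (S y)

  hasTwo-mono : ∀ {S S′} → S ⊆ S′ → HasTwo S → HasTwo S′
  hasTwo-mono S⊆S′ (x , y , x≢y , x∈S , y∈S) = x , y , x≢y , S⊆S′ x∈S , S⊆S′ y∈S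

  ¬hasTwo⇒subsingleton : ∀ {S} → ¬ HasTwo S → ∀ {x y} → x ∈ S → y ∈ S → x ≡ y
  ¬hasTwo⇒subsingleton ¬two {x} {y} x∈S y∈S with x ≟ y
  ... | yes x≡y = x≡y
  ... | no  x≢y = ⊥-elim (¬two (x , y , x≢y , x∈S , y∈S))

  -- Kept opaque: letting evaluated formulas unfold hasTwo? makes type checking blow up.
  opaque
    close : Subset (Fin m) → Subset (Fin m)
    close S x = S x ∨ ⌊ hasTwo? S ⌋

    ∈-close : ∀ S {x} → x ∈ close S ⇔ (x ∈ S ⊎ HasTwo S)
    ∈-close S = mk⇔ (Sum.map₂ toWitness ∘ T-∨ .to) (T-∨ .from ∘ Sum.map₂ fromWitness)

  close-mono : ∀ {S S′} → S ⊆ S′ → close S ⊆ close S′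
  close-mono S⊆S′ = ∈-close _ .from ∘ Sum.map S⊆S′ (hasTwo-mono S⊆S′) ∘ ∈-close _ .to

  close-cong : ∀ {S S′} → S ≗ S′ → close S ≗ close S′
  close-cong S≗S′ x = T-⇔⇒≡ (mk⇔ (close-mono (λ {y} → subst T (S≗S′ y)))
                                (close-mono (λ {y} → subst T (sym (S≗S′ y)))))

  hasTwo-close : ∀ {S} → HasTwo (close S) → HasTwo S
  hasTwo-close {S} two = decidable-stable (hasTwo? S) λ ¬two →
    ¬two (hasTwo-mono (Sum.[ id , ⊥-elim ∘ ¬two ] ∘ ∈-close _ .to) two)

  close-isNEIM : Powerset.IsNEIM close close-cong
  close-isNEIM = record
    { normal     = λ _ → T-⇔⇒≡ (mk⇔ (Sum.[ id , (λ { (_ , _ , _ , () , _) }) ]′ ∘ ∈-close _ .to) λ ())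
    ; extensive  = λ S → ∈-close _ .from ∘ inj₁
    ; idempotent = λ S → Sum.[ id , ∈-close _ .from ∘ inj₂ ∘ hasTwo-close ] ∘ ∈-close _ .to
    ; monotone   = close-mono
    }

closeFrame : ℕ → Frame
closeFrame m = Powerset.frame (close {m}) close-cong

open module CloseFrame {m : ℕ} = Powerset (close {m}) close-cong
  using (⟦_⟧; _⊩_; ⊢E-sound; AxENMRI-valid; module Membership)

-- Formulas that detect the size of closeFrame m

block : (K : ℕ) → Fin (suc K) → Form
block = cell var

-- In closeFrame m, excess K i is the complement of block K i if that block has
-- two points and is empty otherwise, and unreached K i j holds at the points
-- outside the union of two distinct blocks if that union has at most one point.
excess : (K : ℕ) → Fin (suc K) → Form
excess K i = ◇ block K i ∧′ ¬′ block K i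

unreached : (K : ℕ) → Fin (suc K) → Fin K → Form
unreached K i j = ¬′ ◇ (block K i ∨′ block K (punchIn i j))

sizeFormula : ℕ → Form
sizeFormula K = ◇ ⋁ (excess K) ∨′ ⋁ (⋁ ∘ unreached K)

third : ∀ {n} (i k : Fin (3 + n)) → ∃[ j ] j ≢ i × j ≢ k
third i k with 0F ≟ i | 0F ≟ k
... | no 0≢i   | no 0≢k   = 0F , 0≢i , 0≢k
... | yes refl | _ with 1F ≟ k
...   | no 1≢k   = 1F , (λ ()) , 1≢k
...   | yes refl = 2F , (λ ()) , (λ ())
third i k | no 0≢i | yes refl with 1F ≟ i
...   | no 1≢i   = 1F , 1≢i , (λ ())
...   | yes refl = 2F , (λ ()) , (λ ())

-- Let sizeFormula (2 + K) fail at p, and let k be the block of p. As p ∉ ⋁ excess,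
-- every block other than k has at most one point; as every pair of distinct blocks
-- reaches p, every block is inhabited; so if block k had two points, ⋁ excess would
-- contain points of two other blocks. Hence label is a bijection onto Fin (3 + K).
module Refutation {m K : ℕ} (ρ : ℕ → Subset (Fin m)) (p : Fin m)
                  (p∉φ : ¬ p ∈ ⟦ sizeFormula (2 + K) ⟧ ρ) where

  open Membership ρ

  β : Fin (3 + K) → Form
  β = block (2 + K)

  label : Fin m → Fin (3 + K)
  label x = firstTrue (λ l → ρ l x) (2 + K)

  Block : Fin (3 + K) → Subset (Fin m)
  Block i = ⟦ β i ⟧ ρ

  Excess : Subset (Fin m)
  Excess = ⟦ ⋁ (excess (2 + K)) ⟧ ρ

  ∈-Block-label : ∀ x → x ∈ Block (label x)
  ∈-Block-label x = ∈-cell var (2 + K) (label x) .from refl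

  label-of : ∀ {x i} → x ∈ Block i → label x ≡ i
  label-of {i = i} = ∈-cell var (2 + K) i .to

  ∉-Block : ∀ {x i} → label x ≢ i → ¬ x ∈ Block i
  ∉-Block {i = i} x≢i = x≢i ∘ label-of {i = i}

  ∈-Excess : ∀ {x} i → x ∈ close (Block i) → ¬ x ∈ Block i → x ∈ Excess
  ∈-Excess i x∈◇Bi x∉Bi =
    ∈-⋁ (excess (2 + K)) .from (i , ∈-∧′ (◇ β i) (¬′ β i) .from (x∈◇Bi , ∈-¬′ (β i) .from x∉Bi))

  ∈-sizeFormula : p ∈ close Excess ⊎ p ∈ ⟦ ⋁ (⋁ ∘ unreached (2 + K)) ⟧ ρ → p ∈ ⟦ sizeFormula (2 + K) ⟧ ρ
  ∈-sizeFormula = ∈-∨′ (◇ ⋁ (excess (2 + K))) (⋁ (⋁ ∘ unreached (2 + K))) .from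

  p∉close-Excess : ¬ p ∈ close Excess
  p∉close-Excess p∈ = p∉φ (∈-sizeFormula (inj₁ p∈))

  p∉unreached : ∀ i j → ¬ p ∈ ⟦ unreached (2 + K) i j ⟧ ρ
  p∉unreached i j p∈ = p∉φ (∈-sizeFormula (inj₂
    (∈-⋁ (⋁ ∘ unreached (2 + K)) .from (i , ∈-⋁ (unreached (2 + K) i) .from (j , p∈)))))

  Excess-small : ¬ HasTwo Excess
  Excess-small two = p∉close-Excess (∈-close Excess .from (inj₂ two))

  p∈close-pair : ∀ {i j} → i ≢ j → p ∈ close (⟦ β i ∨′ β j ⟧ ρ)
  p∈close-pair {i} {j} i≢j = subst (λ j → p ∈ close (⟦ β i ∨′ β j ⟧ ρ)) (punchIn-punchOut i≢j)
    (decidable-stable (T? (close (⟦ β i ∨′ β (punchIn i (punchOut i≢j)) ⟧ ρ) p))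
      (p∉unreached i (punchOut i≢j) ∘ ∈-¬′ (◇ (β i ∨′ β (punchIn i (punchOut i≢j)))) .from))

  k : Fin (3 + K)
  k = label p

  small-off-k : ∀ {i} → i ≢ k → ¬ HasTwo (Block i)
  small-off-k {i} i≢k two = p∉close-Excess (∈-close Excess .from (inj₁
    (∈-Excess i (∈-close (Block i) .from (inj₂ two)) (∉-Block (i≢k ∘ sym)))))

  p∉Block-pair : ∀ {i j} → i ≢ k → j ≢ k → ¬ p ∈ ⟦ β i ∨′ β j ⟧ ρ
  p∉Block-pair {i} {j} i≢k j≢k =
    Sum.[ ∉-Block (i≢k ∘ sym) , ∉-Block (j≢k ∘ sym) ] ∘ ∈-∨′ (β i) (β j) .to

  ∈-Block-of-pair : ∀ {i j} → j ≢ k → HasTwo (⟦ β i ∨′ β j ⟧ ρ) → ∃[ x ] x ∈ Block i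
  ∈-Block-of-pair {i} {j} j≢k (x , y , x≢y , x∈ , y∈)
    with ∈-∨′ (β i) (β j) .to x∈ | ∈-∨′ (β i) (β j) .to y∈
  ... | inj₁ x∈Bi | _         = x , x∈Bi
  ... | inj₂ _    | inj₁ y∈Bi = y , y∈Bi
  ... | inj₂ x∈Bj | inj₂ y∈Bj = ⊥-elim (small-off-k j≢k (x , y , x≢y , x∈Bj , y∈Bj))

  inhabited : ∀ i → ∃[ x ] x ∈ Block i
  inhabited i with i ≟ k
  ... | yes refl = p , ∈-Block-label p
  ... | no  i≢k  with third i k
  ...   | j , j≢i , j≢k = ∈-Block-of-pair {i} {j} j≢k
      (Sum.[ (λ p∈ → ⊥-elim (p∉Block-pair {i} {j} i≢k j≢k p∈)) , id ]′
        (∈-close (⟦ β i ∨′ β j ⟧ ρ) .to (p∈close-pair {i} {j} (j≢i ∘ sym))))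

  ∈-Excess-off-k : HasTwo (Block k) → ∀ {x i} → x ∈ Block i → i ≢ k → x ∈ Excess
  ∈-Excess-off-k two {x} {i} x∈Bi i≢k = ∈-Excess k (∈-close (Block k) .from (inj₂ two))
    (∉-Block λ lx≡k → i≢k (trans (sym (label-of {x} {i} x∈Bi)) lx≡k))

  small-at-k : ¬ HasTwo (Block k)
  small-at-k two with third k k
  ... | i₁ , _ , i₁≢k with third i₁ k
  ... | i₂ , i₂≢i₁ , i₂≢k with inhabited i₁ | inhabited i₂
  ... | x₁ , x₁∈ | x₂ , x₂∈ = Excess-small
    (x₁ , x₂ , x₁≢x₂ , ∈-Excess-off-k two x₁∈ i₁≢k , ∈-Excess-off-k two x₂∈ i₂≢k)
    where
    x₁≢x₂ : x₁ ≢ x₂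
    x₁≢x₂ refl = i₂≢i₁ (trans (sym (label-of {x₂} {i₂} x₂∈)) (label-of {x₁} {i₁} x₁∈))

  small : ∀ i → ¬ HasTwo (Block i)
  small i with i ≟ k
  ... | yes refl = small-at-k
  ... | no  i≢k  = small-off-k i≢k

  label-injective : ∀ {x y} → label x ≡ label y → x ≡ y
  label-injective {x} {y} lx≡ly = ¬hasTwo⇒subsingleton (small (label y))
    (∈-cell var (2 + K) (label y) .from lx≡ly) (∈-Block-label y)

  representative-injective : ∀ {i j} → proj₁ (inhabited i) ≡ proj₁ (inhabited j) → i ≡ j
  representative-injective {i} {j} eq = trans (sym (label-of {_} {i} (proj₂ (inhabited i))))
    (trans (cong label eq) (label-of {_} {j} (proj₂ (inhabited j))))

  size : m ≡ 3 + K
  size = cantor-schröder-bernstein label-injective representative-injective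

sizeFormula-valid : ∀ {m K} → m ≢ 3 + K → ∀ ρ → ρ ⊩ sizeFormula (2 + K)
sizeFormula-valid {K = K} m≢3+K ρ p =
  decidable-stable (T? (⟦ sizeFormula (2 + K) ⟧ ρ p)) λ p∉φ → m≢3+K (Refutation.size ρ p p∉φ)

ρ₀ : ∀ {n} → ℕ → Subset (Fin n)
ρ₀ l x = toℕ x ≡ᵇ l

firstTrue-ρ₀ : ∀ {K} (x : Fin (suc K)) → firstTrue (λ l → ρ₀ l x) K ≡ x
firstTrue-ρ₀ {zero}  zero    = refl
firstTrue-ρ₀ {suc K} zero    = refl
firstTrue-ρ₀ {suc K} (suc x) = cong suc (firstTrue-ρ₀ x)

module _ (K : ℕ) where
  open Membership (ρ₀ {suc K})

  ∈-block-ρ₀ : ∀ {x i} → x ∈ ⟦ block K i ⟧ ρ₀ ⇔ x ≡ i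
  ∈-block-ρ₀ {x} {i} = mk⇔ (λ x∈ → trans (sym (firstTrue-ρ₀ x)) (∈-cell var K i .to x∈))
                            (λ x≡i → ∈-cell var K i .from (trans (firstTrue-ρ₀ x) x≡i))

  block-ρ₀-small : ∀ i → ¬ HasTwo (⟦ block K i ⟧ ρ₀)
  block-ρ₀-small i (x , y , x≢y , x∈ , y∈) = x≢y (trans (∈-block-ρ₀ .to x∈) (sym (∈-block-ρ₀ .to y∈)))

  ∉-excess-ρ₀ : ∀ {x} → ¬ x ∈ ⟦ ⋁ (excess K) ⟧ ρ₀
  ∉-excess-ρ₀ x∈ with ∈-⋁ (excess K) .to x∈
  ... | i , x∈excess with ∈-∧′ (◇ block K i) (¬′ block K i) .to x∈excess
  ... | x∈◇Bi , x∉Bi =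
    Sum.[ ∈-¬′ (block K i) .to x∉Bi , block-ρ₀-small i ]′ (∈-close (⟦ block K i ⟧ ρ₀) .to x∈◇Bi)

  ∉-unreached-ρ₀ : ∀ {x} i j → ¬ x ∈ ⟦ unreached K i j ⟧ ρ₀
  ∉-unreached-ρ₀ i j x∈ = ∈-¬′ (◇ (block K i ∨′ block K (punchIn i j))) .to x∈ (∈-close _ .from (inj₂
    ( i , punchIn i j , punchInᵢ≢i i j ∘ sym
    , ∈-∨′ (block K i) (block K (punchIn i j)) .from (inj₁ (∈-block-ρ₀ .from refl))
    , ∈-∨′ (block K i) (block K (punchIn i j)) .from (inj₂ (∈-block-ρ₀ .from refl)))))

  sizeFormula-refuted : ¬ (ρ₀ ⊩ sizeFormula K)
  sizeFormula-refuted ⊩φ with ∈-∨′ (◇ ⋁ (excess K)) (⋁ (⋁ ∘ unreached K)) .to (⊩φ zero)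
  ... | inj₁ 0∈◇excess =
    Sum.[ ∉-excess-ρ₀ , (λ (_ , _ , _ , x∈ , _) → ∉-excess-ρ₀ x∈) ]′ (∈-close _ .to 0∈◇excess)
  ... | inj₂ 0∈unreached with ∈-⋁ (⋁ ∘ unreached K) .to 0∈unreached
  ... | i , 0∈ with ∈-⋁ (unreached K i) .to 0∈
  ... | j , 0∈unreached-ij = ∉-unreached-ρ₀ i j 0∈unreached-ij

-- Continuum many logics and varieties

data SizeAxiom (α : ℕ → Bool) : Pred Form 0ℓ where
  size : ∀ n → α n ≡ true → SizeAxiom α (sizeFormula (3 + n))

axioms : (ℕ → Bool) → Pred Form 0ℓ
axioms α = AxENMRI ∪ SizeAxiom α

logic : (ℕ → Bool) → ConsRel
logic α = axExt (axioms α)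

⊢E-weaken : ∀ {Γ Δ φ} → (∀ {ψ} → Γ ψ → Δ ψ) → Γ ⊢E φ → Δ ⊢E φ
⊢E-weaken Γ⊆Δ (hyp γ)  = hyp (Γ⊆Δ γ)
⊢E-weaken Γ⊆Δ (taut t) = taut t
⊢E-weaken Γ⊆Δ (mp d e) = mp (⊢E-weaken Γ⊆Δ d) (⊢E-weaken Γ⊆Δ e)
⊢E-weaken Γ⊆Δ (re d)   = re (⊢E-weaken Γ⊆Δ d)

infix 4 _≈⊤

data AxiomEquation (α : ℕ → Bool) : Pred Equation 0ℓ where
  _≈⊤ : ∀ {φ} → axioms α φ → AxiomEquation α (φ , ⊤′)

Avoids : (ℕ → Bool) → ℕ → Set
Avoids α m = ∀ n → α n ≡ true → m ≢ 4 + n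

avoids-omitted : ∀ {α n} → α n ≡ false → Avoids α (4 + n)
avoids-omitted {α} αn≡false n′ αn′≡true 4+n≡4+n′ =
  case trans (sym αn≡false) (trans (cong α (+-cancelˡ-≡ 4 _ _ 4+n≡4+n′)) αn′≡true) of λ ()

axioms-valid : ∀ {α m} → Avoids α m → (ρ : ℕ → Subset (Fin m)) → ∀ {φ} → axioms α φ → ρ ⊩ φ
axioms-valid avoids ρ (inj₁ ax)               = AxENMRI-valid close-isNEIM ρ ax
axioms-valid avoids ρ (inj₂ (size n αn≡true)) = sizeFormula-valid (avoids n αn≡true) ρ

logic-sound : ∀ {α m Γ φ} → Avoids α m → (ρ : ℕ → Subset (Fin m)) →
              (∀ {ψ} → Γ ψ → ρ ⊩ ψ) → logic α Γ φ → ρ ⊩ φ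
logic-sound avoids ρ ⊩Γ = ⊢E-sound ρ λ { (inj₁ γ) → ⊩Γ γ ; (inj₂ ax) → axioms-valid avoids ρ ax }

closeFrame-⊨ : ∀ {α m} → Avoids α m → closeFrame m ⊨ AxiomEquation α
closeFrame-⊨ avoids φ .⊤′ (ax ≈⊤) ρ x = T-≡ .to (axioms-valid avoids ρ ax x)

⊨AxiomEquation⇒NEIM : ∀ {α} (A : Frame) → A ⊨ AxiomEquation α → NEIM A
⊨AxiomEquation⇒NEIM A ⊨E = AxENMRI-valid⇒NEIM A λ ax ρ → ⊨E _ _ (inj₁ ax ≈⊤) ρ

AxiomEquation-injective : ∀ α β →
  (∀ (A : Frame) → (A ⊨ AxiomEquation α → A ⊨ AxiomEquation β)
                 × (A ⊨ AxiomEquation β → A ⊨ AxiomEquation α)) →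
  ∀ n → α n ≡ β n
AxiomEquation-injective α β same n = ≡-unless-separated
    (λ αn βn → separated αn βn (proj₂ (same (closeFrame (4 + n)))))
    (λ βn αn → separated βn αn (proj₁ (same (closeFrame (4 + n)))))
  where
  separated : ∀ {γ δ} → γ n ≡ true → δ n ≡ false →
              ¬ (closeFrame (4 + n) ⊨ AxiomEquation δ → closeFrame (4 + n) ⊨ AxiomEquation γ)
  separated γn δn δ⇒γ = sizeFormula-refuted (3 + n) λ x →
    T-≡ .from (δ⇒γ (closeFrame-⊨ (avoids-omitted δn)) _ _ (inj₂ (size n γn) ≈⊤) ρ₀ x)

logic-injective : ∀ α β → (∀ Γ φ → (logic α Γ φ → logic β Γ φ) × (logic β Γ φ → logic α Γ φ)) →
                  ∀ n → α n ≡ β n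
logic-injective α β same n = ≡-unless-separated
    (λ αn βn → separated αn βn (proj₁ (same ∅ (sizeFormula (3 + n)))))
    (λ βn αn → separated βn αn (proj₂ (same ∅ (sizeFormula (3 + n)))))
  where
  separated : ∀ {γ δ} → γ n ≡ true → δ n ≡ false →
              ¬ (logic γ ∅ (sizeFormula (3 + n)) → logic δ ∅ (sizeFormula (3 + n)))
  separated γn δn γ⇒δ = sizeFormula-refuted (3 + n)
    (logic-sound (avoids-omitted δn) ρ₀ (λ ()) (γ⇒δ (hyp (inj₂ (inj₂ (size n γn))))))

-- Failure of CEP

Diagonal : Pred (Subset (Fin 3)) 0ℓ
Diagonal S = S 0F ≡ S 1F

close-diagonal : ∀ {S} → Diagonal S → ∀ x → close S x ≡ S x ∨ S 0F
close-diagonal {S} S₀≡S₁ x = T-⇔⇒≡ (mk⇔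
  (T-∨ .from ∘ Sum.map₂ 0∈S-of-two ∘ ∈-close S .to)
  (∈-close S .from ∘ Sum.map₂ (λ 0∈S → 0F , 1F , (λ ()) , 0∈S , subst T S₀≡S₁ 0∈S) ∘ T-∨ .to))
  where
  0∈S-of-two : HasTwo S → 0F ∈ S
  0∈S-of-two (0F , _  , _   , x∈S , _  ) = x∈S
  0∈S-of-two (1F , _  , _   , x∈S , _  ) = subst T (sym S₀≡S₁) x∈S
  0∈S-of-two (2F , 0F , _   , _   , y∈S) = y∈S
  0∈S-of-two (2F , 1F , _   , _   , y∈S) = subst T (sym S₀≡S₁) y∈S
  0∈S-of-two (2F , 2F , x≢y , _   , _  ) = ⊥-elim (x≢y refl)

close-diagonal₀ : ∀ {S} → Diagonal S → close S 0F ≡ S 0F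
close-diagonal₀ {S} S₀≡S₁ = trans (close-diagonal S₀≡S₁ 0F) (∨-idem (S 0F))

close-preserves-diagonal : ∀ {S} → Diagonal S → Diagonal (close S)
close-preserves-diagonal {S} S₀≡S₁ =
  trans (close-diagonal S₀≡S₁ 0F) (trans (cong (_∨ S 0F) S₀≡S₁) (sym (close-diagonal S₀≡S₁ 1F)))

close-point : ∀ (S : Subset (Fin 1)) → close S ≗ S
close-point S x = T-⇔⇒≡ (mk⇔
  (Sum.[ id , (λ { (0F , 0F , x≢y , _) → ⊥-elim (x≢y refl) }) ]′ ∘ ∈-close S .to)
  (∈-close S .from ∘ inj₁))

diagonal-subuniverse : IsSubuniverse (closeFrame 3) Diagonal
diagonal-subuniverse = cong₂ _∧_ , cong not , refl , close-preserves-diagonal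

Agree₀ : Subset (Fin 3) → Subset (Fin 3) → Set
Agree₀ S S′ = S 0F ≡ S′ 0F

agree₀-congruence : IsCongruenceOn (closeFrame 3) Diagonal Agree₀
agree₀-congruence =
    (λ _ _ S≗S′ → S≗S′ 0F) , (λ _ _ → sym) , (λ _ _ _ → trans)
  , (λ _ _ _ _ → cong₂ _∧_) , (λ _ _ → cong not)
  , λ dS dS′ S₀≡S′₀ → trans (close-diagonal₀ dS) (trans S₀≡S′₀ (sym (close-diagonal₀ dS′)))

a u₁ u₂ full : Subset (Fin 3)
a    = true  ∷ true  ∷ false ∷ []
u₁   = true  ∷ false ∷ true  ∷ []
u₂   = false ∷ true  ∷ true  ∷ []
full = true  ∷ true  ∷ true  ∷ []

-- Agree₀ identifies a with full, but this polynomial maps them to ∅ and full.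
separator : Subset (Fin 3) → Subset (Fin 3)
separator z x = close (λ y → z y ∧ u₁ y) x ∧ close (λ y → z y ∧ u₂ y) x

opaque
  unfolding close

  separator-a : ∀ x → separator a x ≡ false
  separator-a 0F = refl
  separator-a 1F = refl
  separator-a 2F = refl

  separator-full : ∀ x → separator full x ≡ true
  separator-full 0F = refl
  separator-full 1F = refl
  separator-full 2F = refl

closeFrame3-¬CEP : ¬ CEP (closeFrame 3)
closeFrame3-¬CEP cep with cep Diagonal Agree₀ diagonal-subuniverse agree₀-congruence
... | Ψ , (Ψ-refl , _ , _ , Ψ-∧ , _ , Ψ-close) , Ψ⇔Agree₀ = case separated of λ ()
  where
  Ψ-a-full : Ψ a full
  Ψ-a-full = proj₂ (Ψ⇔Agree₀ a full refl refl) refl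
  Ψ-separator : Ψ (separator a) (separator full)
  Ψ-separator = Ψ-∧ _ _ _ _ (Ψ-close _ _ (Ψ-∧ _ _ _ _ Ψ-a-full (Ψ-refl _ _ λ _ → refl)))
                            (Ψ-close _ _ (Ψ-∧ _ _ _ _ Ψ-a-full (Ψ-refl _ _ λ _ → refl)))
  separated : false ≡ true
  separated = trans (sym (separator-a 0F))
    (trans (proj₁ (Ψ⇔Agree₀ (separator a) (separator full)
                    (trans (separator-a 0F) (sym (separator-a 1F)))
                    (trans (separator-full 0F) (sym (separator-full 1F)))) Ψ-separator)
           (separator-full 0F))

-- Failure of the local deduction detachment theorem

valuation₃ : ℕ → Subset (Fin 3)
valuation₃ 0 = a
valuation₃ 2 = true  ∷ false ∷ false ∷ []
valuation₃ 3 = true  ∷ false ∷ true  ∷ []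
valuation₃ 4 = false ∷ true  ∷ false ∷ []
valuation₃ 5 = false ∷ true  ∷ true  ∷ []
valuation₃ _ = λ _ → false

valuation₁ : ℕ → Subset (Fin 1)
valuation₁ 0 = λ _ → true
valuation₁ _ = λ _ → false

Γ₃ Γ₁ : Pred Form 0ℓ
Γ₃ φ = valuation₃ ⊩ φ
Γ₁ φ = valuation₁ ⊩ φ

inst : Fm Bool → Form
inst = inst2 (var 0) (var 1)

restriction : ∀ χ → Diagonal (⟦ inst χ ⟧ valuation₃) × ⟦ inst χ ⟧ valuation₃ 0F ≡ ⟦ inst χ ⟧ valuation₁ 0F
restriction (var false) = refl , refl
restriction (var true)  = refl , refl
restriction (χ ∧′ ψ)    = cong₂ _∧_ (proj₁ (restriction χ)) (proj₁ (restriction ψ))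
                        , cong₂ _∧_ (proj₂ (restriction χ)) (proj₂ (restriction ψ))
restriction (¬′ χ)      = cong not (proj₁ (restriction χ)) , cong not (proj₂ (restriction χ))
restriction ⊥′          = refl , refl
restriction (◇ χ)       = close-preserves-diagonal (proj₁ (restriction χ))
                        , trans (close-diagonal₀ (proj₁ (restriction χ)))
                                (trans (proj₂ (restriction χ)) (sym (close-point _ 0F)))

⊩agree₂₃ : valuation₃ ⊩ (var 0 ⇒ (¬′ var 2 ⇔′ ¬′ var 3))
⊩agree₂₃ = λ { 0F → _ ; 1F → _ ; 2F → _ }

⊩agree₄₅ : valuation₃ ⊩ (var 0 ⇒ (¬′ var 4 ⇔′ ¬′ var 5))
⊩agree₄₅ = λ { 0F → _ ; 1F → _ ; 2F → _ }

opaque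
  unfolding close

  ⊩□-disagree : valuation₃ ⊩ ((□ ¬′ var 2 ⇔′ □ ¬′ var 3) ⇒ ((□ ¬′ var 4 ⇔′ □ ¬′ var 5) ⇒ var 1))
  ⊩□-disagree = λ { 0F → _ ; 1F → _ ; 2F → _ }

-- p₀ forces ¬p₂ ↔ ¬p₃ and ¬p₄ ↔ ¬p₅, RE lifts these to □-formulas, and under
-- valuation₃ the two □-equivalences hold at disjoint sets of points.
Γ₃,p₀⊢p₁ : ∀ α → logic α (Γ₃ ∪ ｛ var 0 ｝) (var 1)
Γ₃,p₀⊢p₁ α = mp (□¬-agree 4 5 ⊩agree₄₅) (mp (□¬-agree 2 3 ⊩agree₂₃) (inΓ₃ ⊩□-disagree))
  where
  inΓ₃ : ∀ {φ} → valuation₃ ⊩ φ → logic α (Γ₃ ∪ ｛ var 0 ｝) φ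
  inΓ₃ ⊩φ = hyp (inj₁ (inj₁ ⊩φ))
  □¬-agree : ∀ i j → valuation₃ ⊩ (var 0 ⇒ (¬′ var i ⇔′ ¬′ var j)) →
             logic α (Γ₃ ∪ ｛ var 0 ｝) (□ ¬′ var i ⇔′ □ ¬′ var j)
  □¬-agree i j ⊩agree = re {φ = ¬′ var i} {ψ = ¬′ var j} (mp (hyp (inj₁ (inj₂ refl))) (inΓ₃ ⊩agree))

logic-¬LDDT : ∀ α → ¬ LDDT (logic α)
logic-¬LDDT α (I , L , ldt) with proj₁ (ldt Γ₃ (var 0) (var 1)) (Γ₃,p₀⊢p₁ α)
... | i , Γ₃⊢L = case logic-sound (λ _ _ ()) valuation₁ ⊩Γ₁,p₀ Γ₁,p₀⊢p₁ 0F of λ ()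
  where
  Γ₁⊢L : All (λ χ → logic α Γ₁ (inst χ)) (L i)
  Γ₁⊢L = All.map (λ {χ} Γ₃⊢χ → hyp (inj₁ λ { 0F →
    subst T (proj₂ (restriction χ)) (logic-sound (λ _ _ ()) valuation₃ id Γ₃⊢χ 0F) })) Γ₃⊢L
  Γ₁,p₀⊢p₁ : logic α (Γ₁ ∪ ｛ var 0 ｝) (var 1)
  Γ₁,p₀⊢p₁ = proj₂ (ldt Γ₁ (var 0) (var 1)) (i , Γ₁⊢L)
  ⊩Γ₁,p₀ : ∀ {ψ} → (Γ₁ ∪ ｛ var 0 ｝) ψ → valuation₁ ⊩ ψ
  ⊩Γ₁,p₀ (inj₁ ⊩ψ)   = ⊩ψ
  ⊩Γ₁,p₀ (inj₂ refl) = λ { 0F → _ }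

corollary1p3 :
    -- (1) continuum many varieties of NEIM Boolean frames lacking CEP:
    -- an injective assignment α ↦ V(E α) from 2^ℕ to varieties
    (Σ[ E ∈ ((ℕ → Bool) → Pred Equation 0ℓ) ]
      ((∀ α (A : Frame) → A ⊨ E α → NEIM A)
      × (∀ α → Σ[ A ∈ Frame ] (A ⊨ E α × ¬ CEP A))
      × (∀ α β → (∀ (A : Frame) → (A ⊨ E α → A ⊨ E β) × (A ⊨ E β → A ⊨ E α))
               → ∀ n → α n ≡ β n)))
    ×
    -- (2) continuum many axiomatic extensions of ⊢ENMRI without LDDT
    (Σ[ C ∈ ((ℕ → Bool) → ConsRel) ]
      ((∀ α → IsAxExtOfENMRI (C α))
      × (∀ α → ¬ LDDT (C α))
      × (∀ α β → (∀ Γ φ → (C α Γ φ → C β Γ φ) × (C β Γ φ → C α Γ φ))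
               → ∀ n → α n ≡ β n)))
corollary1p3 =
  ( AxiomEquation
  , (λ α → ⊨AxiomEquation⇒NEIM)
  , (λ α → closeFrame 3 , closeFrame-⊨ (λ _ _ ()) , closeFrame3-¬CEP)
  , AxiomEquation-injective )
  ,
  ( logic
  , (λ α → axioms α , (λ Γ φ → id , id) , λ Γ φ → ⊢E-weaken (Sum.map₂ inj₁))
  , logic-¬LDDT
  , logic-injective )
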